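{- Let $\chi_1,\chi_2$ be primitive quadratic Dirichlet characters of respective conductors $q_1,q_2$ with $\chi_1\chi_2(-1)=1$, and suppose $q_1,q_2>4$ are both odd. Then \[ S_{\chi_1,\chi_2}(\Gamma_0(q_1q_2)) \subseteq \frac{1}{\gcd(q_1,q_2)}\,\mathbb{Z}. \]
   Context: $B_1(x)=0$ if $x\in\mathbb{Z}$ and $B_1(x)=x-\lfloor x\rfloor-\tfrac12$ otherwise. $\Gamma_0(N)$ is the group of matrices $\begin{pmatrix}a&b\\c&d\end{pmatrix}\in SL_2(\mathbb{Z})$ with $N\mid c$. For $\gamma=\begin{pmatrix}a&b\\c&d\end{pmatrix}\in\Gamma_0(q_1q_2)$ with $c\ge 1$, the newform Dedekind sum is \[S_{\chi_1,\chi_2}(\gamma)=S_{\chi_1,\chi_2}(a,c)=\sum_{j \bmod c}\ \sum_{n \bmod q_1}\overline{\chi_2}(j)\overline{\chi_1}(n)B_1\Big(\frac{j}{c}\Big)B_1\Big(\frac{n}{q_1}+\frac{aj}{c}\Big);\] it is extended to all of $\Gamma_0(q_1q_2)$ by $S_{\chi_1,\chi_2}(\gamma)=0$ if $c=0$ and $S_{\chi_1,\chi_2}(\gamma)=S_{\chi_1,\chi_2}(-\gamma)$ if $c<0$ (this is the map arising from newform Eisenstein series, which satisfies $S(\gamma_1\gamma_2)=S(\gamma_1)+\chi_1\overline{\chi_2}(d_1)S(\gamma_2)$ where $d_1$ is the lower-right entry of $\gamma_1$). -}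

module Defs where

open import Data.Nat as ℕ using (ℕ; zero; suc; _<_)
open import Data.Nat.Divisibility as ℕD using ()
open import Data.Nat.Coprimality using (Coprime)
open import Data.Integer as ℤ using (ℤ; +_; -[1+_]; ∣_∣; 0ℤ; 1ℤ; -1ℤ)
open import Data.Integer.Divisibility as ℤD using ()
open import Data.Rational as ℚ using (ℚ; 0ℚ; ½; floor)
open import Data.Rational.Properties as ℚP using ()
open import Data.List using (List; upTo; foldr; map)
open import Data.Product using (_×_; ∃)
open import Data.Sum using (_⊎_)
open import Relation.Nullary using (¬_; yes; no)
open import Relation.Binary.PropositionalEquality using (_≡_; _≢_)

-- A Dirichlet character modulo q taking values in ℤ (enough for real,
-- in particular quadratic, characters), viewed as a function on ℤ.
record IsDirichletCharacter (q : ℕ) (χ : ℤ → ℤ) : Set where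
  field
    mult     : ∀ m n → χ (m ℤ.* n) ≡ χ m ℤ.* χ n
    one      : χ 1ℤ ≡ 1ℤ
    periodic : ∀ n → χ (n ℤ.+ + q) ≡ χ n
    zero-out : ∀ n → ¬ Coprime ∣ n ∣ q → χ n ≡ 0ℤ
    nonzero  : ∀ n → Coprime ∣ n ∣ q → χ n ≢ 0ℤ

-- Primitive modulo q (i.e. of conductor q): for every proper divisor d of q,
-- χ is not induced from modulus d, i.e. there is n ≡ 1 (mod d), coprime to q,
-- with χ(n) ≠ 1.
IsPrimitive : ℕ → (ℤ → ℤ) → Set
IsPrimitive q χ =
  ∀ d → d ℕD.∣ q → d < q →
  ∃ λ n → ((+ d) ℤD.∣ (n ℤ.- 1ℤ)) × Coprime ∣ n ∣ q × χ n ≢ 1ℤ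

-- Quadratic: real-valued with values in {0, 1, -1}, and of order exactly 2
-- (takes the value -1 somewhere).
IsQuadratic : (ℤ → ℤ) → Set
IsQuadratic χ = (∀ n → χ n ≡ 0ℤ ⊎ χ n ≡ 1ℤ ⊎ χ n ≡ -1ℤ) × ∃ λ n → χ n ≡ -1ℤ

IsPrimitiveQuadraticChar : ℕ → (ℤ → ℤ) → Set
IsPrimitiveQuadraticChar q χ =
  IsDirichletCharacter q χ × IsPrimitive q χ × IsQuadratic χ

-- m / k as a rational (0 if k = 0; only used with k ≥ 1).
ratio : ℤ → ℕ → ℚ
ratio m zero    = 0ℚ
ratio m (suc k) = m ℚ./ suc k

fromℤ : ℤ → ℚ
fromℤ m = m ℚ./ 1

B₁ : ℚ → ℚ
B₁ x with x ℚ.- fromℤ (floor x) ℚP.≟ 0ℚ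
... | yes _ = 0ℚ
... | no  _ = x ℚ.- fromℤ (floor x) ℚ.- ½

sumℚ : List ℚ → ℚ
sumℚ = foldr ℚ._+_ 0ℚ

-- S_{χ1,χ2}(a,c) for c ≥ 1 (c given as a natural number); the characters
-- are real, so complex conjugation is the identity.
S-ac : (χ₁ χ₂ : ℤ → ℤ) (q₁ : ℕ) → ℤ → ℕ → ℚ
S-ac χ₁ χ₂ q₁ a c =
  sumℚ (map (λ j → sumℚ (map (λ n →
      fromℤ (χ₂ (+ j) ℤ.* χ₁ (+ n))
      ℚ.* B₁ (ratio (+ j) c)
      ℚ.* B₁ (ratio (+ n) q₁ ℚ.+ ratio (a ℤ.* + j) c))
    (upTo q₁)))
    (upTo c))

-- S_{χ1,χ2}(γ) for γ = (a b; c d): 0 if c = 0, S(a,c) if c > 0,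
-- S(-γ) = S(-a,-c) if c < 0.
S-γ : (χ₁ χ₂ : ℤ → ℤ) (q₁ : ℕ) → (a b c d : ℤ) → ℚ
S-γ χ₁ χ₂ q₁ a b (+ zero)    d = 0ℚ
S-γ χ₁ χ₂ q₁ a b (+ suc k)   d = S-ac χ₁ χ₂ q₁ a (suc k)
S-γ χ₁ χ₂ q₁ a b (-[1+ k ])  d = S-ac χ₁ χ₂ q₁ (ℤ.- a) (suc k)

InΓ₀ : ℕ → (a b c d : ℤ) → Set
InΓ₀ N a b c d = (a ℤ.* d ℤ.- b ℤ.* c ≡ 1ℤ) × ((+ N) ℤD.∣ c)

{-# OPTIONS --safe #-}
module Submission where

-- S_{χ₁,χ₂}(γ) is in fact an integer.
--
-- Write c = q₁ M with q₂ ∣ M. When χ₂(j) ≠ 0 both arguments of B₁ are non-integral with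
-- denominator c, so 4c² S = Σ_{j,n} χ₂(j) χ₁(n) (2 (j mod c) - c) (2 ((n M + a j) mod c) - c).
-- Comparing Σ χ₁(n) n with its twist by n ↦ b n shows that q₁ / gcd(q₁, Σ χ₁(n) n) divides
-- 1 - χ₁(b) b for every b prime to q₁; with b = 2 and primitivity this forces
-- q₁ ∣ Σ χ₁(n) n (here q₁ odd and q₁ > 4 are used). As Σ χ₁(n) = 0, it follows that
-- Q(t) = Σ χ₁(n) ((n + t) mod q₁) = q₁ Q′(t), and the sum over n is 2c Q′(a j div M).
-- It remains to see that P = Σ_j χ₂(j) (2j - c) Q′(a j div M) is divisible by 2c: writing
-- j = s M + u, the substitution t ≡ a s + (a u div M) (mod q₁) shows that the inner sum
-- over s is 2 M d Σ_t t Q′(t) modulo 2c, independently of u, while Σ_{u < M} χ₂(u) = 0.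

open import Defs

module _ where
  open import Data.Nat as ℕ using (ℕ; zero; suc; z≤n; s≤s; NonZero)
  import Data.Nat.Properties as ℕP
  open import Algebra.Properties.CommutativeSemigroup ℕP.*-commutativeSemigroup using (x∙yz≈y∙xz)
  import Data.Nat.Divisibility as ℕD
  open import Data.Nat.DivMod using (m/n*n≡m)
  open import Data.Nat.GCD using (module Bézout; gcd; gcd-identityˡ; gcd[m,n]∣m; gcd[m,n]∣n; gcd[m,n]≢0)
  open import Data.Nat.Coprimality as Coprimality using (Coprime; coprime?; coprime-Bézout)
  open import Data.Integer as ℤ using (ℤ; +_; -[1+_]; 0ℤ; 1ℤ; -1ℤ; ∣_∣; _+_; _*_; -_; _-_; _%ℕ_; _/ℕ_)
  import Data.Integer.Properties as ℤP
  open import Data.Integer.DivMod using (a≡a%ℕn+[a/ℕn]*n; n%ℕd<d; [n/ℕd]*d≤n; n<s[n/ℕd]*d; div-pos-is-/ℕ)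
  import Data.Integer.Divisibility as ℤD
  open import Data.Integer.Divisibility.Signed
    using (_∣_; divides; ∣m∣n⇒∣m+n; ∣m∣n⇒∣m-n; ∣m+n∣m⇒∣n; ∣n⇒∣m*n; ∣m⇒∣m*n; ∣-trans; *-monoʳ-∣; ∣⇒∣ᵤ; ∣ᵤ⇒∣)
  open import Data.Integer.Tactic.RingSolver using (solve-∀)
  open import Algebra.Properties.AbelianGroup ℤP.+-0-abelianGroup using () renaming (∙-cancelʳ to +-cancelʳ)
  import Algebra.Properties.Semiring.Sum as SemiringSum
  open import Data.Rational as ℚ using (ℚ; mkℚ; 0ℚ; ½; floor; ↥_; ↧_; ↧ₙ_; toℚᵘ)
  import Data.Rational.Properties as ℚP
  open import Data.Rational.Unnormalised as ℚᵘ using (mkℚᵘ; *≡*)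
  import Data.Rational.Unnormalised.Properties as ℚᵘP
  open import Data.Fin using (Fin; toℕ; fromℕ<)
  import Data.Fin.Properties as FinP
  open import Data.Fin.Permutation using (permutation)
  open import Data.List using (map; applyUpTo; upTo)
  open import Data.Product using (_×_; _,_; proj₁; proj₂; ∃)
  open import Data.Sum using (_⊎_; inj₁; inj₂)
  open import Data.Empty using (⊥-elim)
  open import Function using (_∘_; id)
  open import Relation.Nullary using (¬_; yes; no)
  open import Relation.Binary.PropositionalEquality

  -- Sums over ranges

  module ℤΣ = SemiringSum ℤP.+-*-semiring

  Σ< : ℕ → (ℕ → ℤ) → ℤ
  Σ< n f = ℤΣ.sum {n} (f ∘ toℕ)

  infix 5 Σ<
  syntax Σ< n (λ i → e) = Σ[ i < n ] e

  Σ-cong : ∀ n {f g : ℕ → ℤ} → (∀ i → i ℕ.< n → f i ≡ g i) → Σ< n f ≡ Σ< n g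
  Σ-cong zero    f≡g = refl
  Σ-cong (suc n) f≡g = cong₂ _+_ (f≡g 0 (s≤s z≤n)) (Σ-cong n (λ i i<n → f≡g (suc i) (s≤s i<n)))

  Σ-zero : ∀ n → Σ[ i < n ] 0ℤ ≡ 0ℤ
  Σ-zero = ℤΣ.sum-replicate-zero

  Σ-distrib-+ : ∀ n f g → Σ[ i < n ] (f i + g i) ≡ Σ< n f + Σ< n g
  Σ-distrib-+ n f g = ℤΣ.∑-distrib-+ {n} (f ∘ toℕ) (g ∘ toℕ)

  Σ-*ˡ : ∀ n k f → Σ[ i < n ] (k * f i) ≡ k * Σ< n f
  Σ-*ˡ n k f = sym (ℤΣ.*-distribˡ-sum {n} k (f ∘ toℕ))

  Σ-*ʳ : ∀ n k f → Σ[ i < n ] (f i * k) ≡ Σ< n f * k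
  Σ-*ʳ n k f = sym (ℤΣ.*-distribʳ-sum {n} k (f ∘ toℕ))

  Σ-distrib-neg : ∀ n f → Σ[ i < n ] (- f i) ≡ - Σ< n f
  Σ-distrib-neg zero    f = refl
  Σ-distrib-neg (suc n) f = trans (cong (_+_ (- f 0)) (Σ-distrib-neg n (f ∘ suc))) (sym (ℤP.neg-distrib-+ (f 0) _))

  Σ-distrib-- : ∀ n f g → Σ[ i < n ] (f i - g i) ≡ Σ< n f - Σ< n g
  Σ-distrib-- n f g = trans (Σ-distrib-+ n f (λ i → - g i)) (cong (_+_ (Σ< n f)) (Σ-distrib-neg n g))

  Σ-swap : ∀ m n (f : ℕ → ℕ → ℤ) → Σ[ i < m ] Σ[ j < n ] f i j ≡ Σ[ j < n ] Σ[ i < m ] f i j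
  Σ-swap m n f = ℤΣ.∑-comm {m} {n} (λ i j → f (toℕ i) (toℕ j))

  Σ-++ : ∀ m n f → Σ< (m ℕ.+ n) f ≡ Σ< m f + (Σ[ i < n ] f (m ℕ.+ i))
  Σ-++ zero    n f = sym (ℤP.+-identityˡ _)
  Σ-++ (suc m) n f = trans (cong (_+_ (f 0)) (Σ-++ m n (f ∘ suc))) (sym (ℤP.+-assoc (f 0) _ _))

  Σ-blocks : ∀ s M f → Σ< (s ℕ.* M) f ≡ Σ[ i < s ] Σ[ u < M ] f (i ℕ.* M ℕ.+ u)
  Σ-blocks zero    M f = refl
  Σ-blocks (suc s) M f = trans (Σ-++ M (s ℕ.* M) f) (cong (_+_ (Σ< M f)) (trans (Σ-blocks s M (λ i → f (M ℕ.+ i)))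
    (Σ-cong s (λ i _ → Σ-cong M (λ u _ → cong f (sym (ℕP.+-assoc M (i ℕ.* M) u)))))))

  Σ-periodic : ∀ s M f → (∀ i u → f (i ℕ.* M ℕ.+ u) ≡ f u) → Σ< (s ℕ.* M) f ≡ Σ< s (λ _ → Σ< M f)
  Σ-periodic s M f periodic = trans (Σ-blocks s M f) (Σ-cong s (λ i _ → Σ-cong M (λ u _ → periodic i u)))

  Σ-∣ : ∀ n k f → (∀ i → i ℕ.< n → k ∣ f i) → k ∣ Σ< n f
  Σ-∣ zero    k f k∣f = divides 0ℤ refl
  Σ-∣ (suc n) k f k∣f = ∣m∣n⇒∣m+n (k∣f 0 (s≤s z≤n)) (Σ-∣ n k (f ∘ suc) (λ i i<n → k∣f (suc i) (s≤s i<n)))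

  Σ-permute : ∀ n (π π⁻¹ : ℕ → ℕ) (F : ℕ → ℤ) →
    (∀ i → i ℕ.< n → π i ℕ.< n) → (∀ i → i ℕ.< n → π⁻¹ i ℕ.< n) →
    (∀ i → i ℕ.< n → π (π⁻¹ i) ≡ i) → (∀ i → i ℕ.< n → π⁻¹ (π i) ≡ i) →
    Σ[ i < n ] F (π i) ≡ Σ< n F
  Σ-permute n π π⁻¹ F π<n π⁻¹<n ππ⁻¹ π⁻¹π =
    trans (ℤΣ.sum-cong-≗ {n} (λ i → cong F (sym (FinP.toℕ-fromℕ< _)))) (sym (ℤΣ.sum-permute (F ∘ toℕ) σ))
    where
    onFin : (f : ℕ → ℕ) → (∀ i → i ℕ.< n → f i ℕ.< n) → Fin n → Fin n
    onFin f f<n i = fromℕ< (f<n (toℕ i) (FinP.toℕ<n i))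
    onFin-inverse : ∀ f g f<n g<n → (∀ i → i ℕ.< n → f (g i) ≡ i) → ∀ i → onFin f f<n (onFin g g<n i) ≡ i
    onFin-inverse f g f<n g<n fg i = FinP.toℕ-injective (begin
      toℕ (onFin f f<n (onFin g g<n i)) ≡⟨ FinP.toℕ-fromℕ< _ ⟩
      f (toℕ (onFin g g<n i))           ≡⟨ cong f (FinP.toℕ-fromℕ< _) ⟩
      f (g (toℕ i))                     ≡⟨ fg (toℕ i) (FinP.toℕ<n i) ⟩
      toℕ i                             ∎)
      where open ≡-Reasoning
    σ = permutation (onFin π π<n) (onFin π⁻¹ π⁻¹<n)
          (onFin-inverse π π⁻¹ π<n π⁻¹<n ππ⁻¹) (onFin-inverse π⁻¹ π π⁻¹<n π<n π⁻¹π)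

  -- Division with remainder by a positive natural number

  module _ (q : ℕ) .{{_ : NonZero q}} where

    /ℕ-unique : ∀ x r t → r ℕ.< q → x ≡ + r + t * + q → x /ℕ q ≡ t
    /ℕ-unique x r t r<q x≡ = ℤP.≤-antisym
      (bounded (x /ℕ q) t ([n/ℕd]*d≤n x q) x<[1+t]q)
      (bounded t (x /ℕ q) tq≤x (n<s[n/ℕd]*d x q))
      where
      bounded : ∀ s t → s * + q ℤ.≤ x → x ℤ.< ℤ.suc t * + q → s ℤ.≤ t
      bounded s t sq≤x x<[1+t]q = subst (s ℤ.≤_) (ℤP.pred-suc t)
        (ℤP.i<j⇒i≤pred[j] {j = ℤ.suc t} (ℤP.*-cancelʳ-<-nonNeg (+ q) (ℤP.≤-<-trans sq≤x x<[1+t]q)))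
      tq≤x : t * + q ℤ.≤ x
      tq≤x = subst (t * + q ℤ.≤_) (sym x≡) (ℤP.i≤j+i (t * + q) (+ r))
      x<[1+t]q : x ℤ.< ℤ.suc t * + q
      x<[1+t]q = subst₂ ℤ._<_ (sym x≡) (sym (ℤP.suc-* t (+ q))) (ℤP.+-monoˡ-< (t * + q) (ℤ.+<+ r<q))

    %ℕ-unique : ∀ x r t → r ℕ.< q → x ≡ + r + t * + q → x %ℕ q ≡ r
    %ℕ-unique x r t r<q x≡ = ℤP.+-injective (+-cancelʳ (t * + q) _ _ (begin
      + (x %ℕ q) + t * + q         ≡⟨ cong (λ s → + (x %ℕ q) + s * + q) (/ℕ-unique x r t r<q x≡) ⟨
      + (x %ℕ q) + x /ℕ q * + q    ≡⟨ a≡a%ℕn+[a/ℕn]*n x q ⟨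
      x                            ≡⟨ x≡ ⟩
      + r + t * + q                ∎))
      where open ≡-Reasoning

    n<q⇒n%ℕq≡n : ∀ n → n ℕ.< q → + n %ℕ q ≡ n
    n<q⇒n%ℕq≡n n n<q = %ℕ-unique (+ n) n 0ℤ n<q (sym (ℤP.+-identityʳ (+ n)))

    private
      x+kq≡r+[t+k]q : ∀ x k → x + k * + q ≡ + (x %ℕ q) + (x /ℕ q + k) * + q
      x+kq≡r+[t+k]q x k = trans (cong (_+ k * + q) (a≡a%ℕn+[a/ℕn]*n x q)) (regroup (+ (x %ℕ q)) (x /ℕ q) k (+ q))
        where
        regroup : ∀ r t k q → r + t * q + k * q ≡ r + (t + k) * q
        regroup = solve-∀

    [x+kq]%ℕq≡x%ℕq : ∀ x k → (x + k * + q) %ℕ q ≡ x %ℕ q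
    [x+kq]%ℕq≡x%ℕq x k = %ℕ-unique (x + k * + q) (x %ℕ q) (x /ℕ q + k) (n%ℕd<d x q) (x+kq≡r+[t+k]q x k)

    [x+kq]/ℕq≡x/ℕq+k : ∀ x k → (x + k * + q) /ℕ q ≡ x /ℕ q + k
    [x+kq]/ℕq≡x/ℕq+k x k = /ℕ-unique (x + k * + q) (x %ℕ q) (x /ℕ q + k) (n%ℕd<d x q) (x+kq≡r+[t+k]q x k)

    %ℕ-cong : ∀ x y → + q ∣ x - y → x %ℕ q ≡ y %ℕ q
    %ℕ-cong x y (divides k x-y≡kq) = trans (cong (_%ℕ q) x≡y+kq) ([x+kq]%ℕq≡x%ℕq y k)
      where
      x≡y+kq : x ≡ y + k * + q
      x≡y+kq = trans (sym (y+[x-y]≡x x y)) (cong (_+_ y) x-y≡kq)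
        where
        y+[x-y]≡x : ∀ x y → y + (x - y) ≡ x
        y+[x-y]≡x = solve-∀

    ∣x-x%ℕq : ∀ x → + q ∣ x - + (x %ℕ q)
    ∣x-x%ℕq x = divides (x /ℕ q)
      (trans (cong (_- + (x %ℕ q)) (a≡a%ℕn+[a/ℕn]*n x q)) (r+s-r≡s (+ (x %ℕ q)) (x /ℕ q * + q)))
      where
      r+s-r≡s : ∀ r s → r + s - r ≡ s
      r+s-r≡s = solve-∀

    %ℕ≡0⇒∣ : ∀ x → x %ℕ q ≡ 0 → + q ∣ x
    %ℕ≡0⇒∣ x x%q≡0 = subst (+ q ∣_) (trans (cong (λ r → x - + r) x%q≡0) (ℤP.+-identityʳ x)) (∣x-x%ℕq x)

  %ℕ-split : ∀ q M c .{{_ : NonZero q}} .{{_ : NonZero M}} .{{_ : NonZero c}} → c ≡ q ℕ.* M → ∀ y x →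
    (y * + M + x) %ℕ c ≡ M ℕ.* ((y + x /ℕ M) %ℕ q) ℕ.+ x %ℕ M
  %ℕ-split q M c c≡qM y x = %ℕ-unique c (y * + M + x) (M ℕ.* r ℕ.+ s) (z /ℕ q) bound y*M+x≡
    where
    z = y + x /ℕ M
    r = z %ℕ q
    s = x %ℕ M
    bound : M ℕ.* r ℕ.+ s ℕ.< c
    bound = begin-strict
      M ℕ.* r ℕ.+ s      <⟨ ℕP.+-monoʳ-< (M ℕ.* r) (n%ℕd<d x M) ⟩
      M ℕ.* r ℕ.+ M      ≡⟨ ℕP.+-comm (M ℕ.* r) M ⟩
      M ℕ.+ M ℕ.* r      ≡⟨ ℕP.*-suc M r ⟨
      M ℕ.* suc r        ≤⟨ ℕP.*-monoʳ-≤ M (n%ℕd<d z q) ⟩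
      M ℕ.* q            ≡⟨ ℕP.*-comm M q ⟩
      q ℕ.* M            ≡⟨ c≡qM ⟨
      c                  ∎
      where open ℕP.≤-Reasoning
    y*M+x≡ : y * + M + x ≡ + (M ℕ.* r ℕ.+ s) + z /ℕ q * + c
    y*M+x≡ = begin
      y * + M + x
        ≡⟨ cong (_+_ (y * + M)) (a≡a%ℕn+[a/ℕn]*n x M) ⟩
      y * + M + (+ s + x /ℕ M * + M)
        ≡⟨ regroup₁ y (+ s) (x /ℕ M) (+ M) ⟩
      + s + z * + M
        ≡⟨ cong (λ w → + s + w * + M) (a≡a%ℕn+[a/ℕn]*n z q) ⟩
      + s + (+ r + z /ℕ q * + q) * + M
        ≡⟨ regroup₂ (+ s) (+ r) (z /ℕ q) (+ q) (+ M) ⟩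
      + M * + r + + s + z /ℕ q * (+ q * + M)
        ≡⟨ cong₂ (λ u v → u + + s + z /ℕ q * v) (ℤP.pos-* M r) (ℤP.pos-* q M) ⟨
      + (M ℕ.* r) + + s + z /ℕ q * + (q ℕ.* M)
        ≡⟨ cong (_+ z /ℕ q * + (q ℕ.* M)) (ℤP.pos-+ (M ℕ.* r) s) ⟨
      + (M ℕ.* r ℕ.+ s) + z /ℕ q * + (q ℕ.* M)
        ≡⟨ cong (λ n → + (M ℕ.* r ℕ.+ s) + z /ℕ q * + n) c≡qM ⟨
      + (M ℕ.* r ℕ.+ s) + z /ℕ q * + c
        ∎
      where
      open ≡-Reasoning
      regroup₁ : ∀ y s t m → y * m + (s + t * m) ≡ s + (y + t) * m
      regroup₁ = solve-∀
      regroup₂ : ∀ s r t q m → s + (r + t * q) * m ≡ m * r + s + t * (q * m)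
      regroup₂ = solve-∀

  -- Affine permutations of the residues modulo q

  module AffinePermutation (q : ℕ) .{{_ : NonZero q}} {a a⁻¹ : ℤ} (aa⁻¹≡1 : + q ∣ a * a⁻¹ - 1ℤ) (σ : ℤ) where

    affine : ℕ → ℕ
    affine s = (a * + s + σ) %ℕ q

    affine⁻¹ : ℕ → ℕ
    affine⁻¹ t = (a⁻¹ * (+ t - σ)) %ℕ q

    affine⁻¹-affine : ∀ s → s ℕ.< q → affine⁻¹ (affine s) ≡ s
    affine⁻¹-affine s s<q = trans (%ℕ-cong q (a⁻¹ * (+ (x %ℕ q) - σ)) (+ s) q∣diff) (n<q⇒n%ℕq≡n q s s<q)
      where
      x = a * + s + σ
      rearrange : ∀ a a⁻¹ s σ r → - a⁻¹ * (a * s + σ - r) + (a * a⁻¹ - 1ℤ) * s ≡ a⁻¹ * (r - σ) - s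
      rearrange = solve-∀
      q∣diff : + q ∣ a⁻¹ * (+ (x %ℕ q) - σ) - + s
      q∣diff = subst (+ q ∣_) (rearrange a a⁻¹ (+ s) σ (+ (x %ℕ q)))
        (∣m∣n⇒∣m+n (∣n⇒∣m*n (- a⁻¹) (∣x-x%ℕq q x)) (∣m⇒∣m*n (+ s) aa⁻¹≡1))

    affine-affine⁻¹ : ∀ t → t ℕ.< q → affine (affine⁻¹ t) ≡ t
    affine-affine⁻¹ t t<q = trans (%ℕ-cong q (a * + (y %ℕ q) + σ) (+ t) q∣diff) (n<q⇒n%ℕq≡n q t t<q)
      where
      y = a⁻¹ * (+ t - σ)
      rearrange : ∀ a a⁻¹ t σ r → - a * (a⁻¹ * (t - σ) - r) + (a * a⁻¹ - 1ℤ) * (t - σ) ≡ a * r + σ - t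
      rearrange = solve-∀
      q∣diff : + q ∣ a * + (y %ℕ q) + σ - + t
      q∣diff = subst (+ q ∣_) (rearrange a a⁻¹ (+ t) σ (+ (y %ℕ q)))
        (∣m∣n⇒∣m+n (∣n⇒∣m*n (- a) (∣x-x%ℕq q y)) (∣m⇒∣m*n (+ t - σ) aa⁻¹≡1))

    Σ-affine : ∀ F → Σ[ s < q ] F (affine s) ≡ Σ< q F
    Σ-affine F = Σ-permute q affine affine⁻¹ F
      (λ s _ → n%ℕd<d (a * + s + σ) q) (λ t _ → n%ℕd<d (a⁻¹ * (+ t - σ)) q)
      affine-affine⁻¹ affine⁻¹-affine

  open AffinePermutation public

  private
    pos-1+ab≡cd : ∀ a b c d → 1 ℕ.+ a ℕ.* b ≡ c ℕ.* d → 1ℤ + + a * + b ≡ + c * + d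
    pos-1+ab≡cd a b c d eq =
      trans (cong (_+_ 1ℤ) (sym (ℤP.pos-* a b))) (trans (cong +_ eq) (ℤP.pos-* c d))

    inverse-modℕ : ∀ n q → Coprime n q → ∃ λ n⁻¹ → + q ∣ + n * n⁻¹ - 1ℤ
    inverse-modℕ n q n⊥q with coprime-Bézout n⊥q
    ... | Bézout.+- x y 1+yq≡xn = + x , divides (+ y) (begin
      + n * + x - 1ℤ       ≡⟨ cong (_- 1ℤ) (ℤP.*-comm (+ n) (+ x)) ⟩
      + x * + n - 1ℤ       ≡⟨ cong (_- 1ℤ) (pos-1+ab≡cd y q x n 1+yq≡xn) ⟨
      1ℤ + + y * + q - 1ℤ  ≡⟨ 1+m-1≡m (+ y * + q) ⟩
      + y * + q            ∎)
      where
      open ≡-Reasoning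
      1+m-1≡m : ∀ m → 1ℤ + m - 1ℤ ≡ m
      1+m-1≡m = solve-∀
    ... | Bézout.-+ x y 1+xn≡yq = - + x , divides (- + y) (begin
      + n * - + x - 1ℤ     ≡⟨ n[-x]-1≡-[1+xn] (+ n) (+ x) ⟩
      - (1ℤ + + x * + n)   ≡⟨ cong -_ (pos-1+ab≡cd x n y q 1+xn≡yq) ⟩
      - (+ y * + q)        ≡⟨ ℤP.neg-distribˡ-* (+ y) (+ q) ⟩
      - + y * + q          ∎)
      where
      open ≡-Reasoning
      n[-x]-1≡-[1+xn] : ∀ n x → n * - x - 1ℤ ≡ - (1ℤ + x * n)
      n[-x]-1≡-[1+xn] = solve-∀

  inverse-mod : ∀ b q → Coprime ∣ b ∣ q → ∃ λ b⁻¹ → + q ∣ b * b⁻¹ - 1ℤ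
  inverse-mod (+ n)    q n⊥q = inverse-modℕ n q n⊥q
  inverse-mod -[1+ n ] q n⊥q with inverse-modℕ (suc n) q n⊥q
  ... | n⁻¹ , q∣nn⁻¹-1 = - n⁻¹ , subst (+ q ∣_) (neg-cancel (+ suc n) n⁻¹) q∣nn⁻¹-1
    where
    neg-cancel : ∀ n n⁻¹ → n * n⁻¹ - 1ℤ ≡ - n * - n⁻¹ - 1ℤ
    neg-cancel = solve-∀

  module DirichletCharacter {q : ℕ} .{{_ : NonZero q}} {χ : ℤ → ℤ} (isχ : IsDirichletCharacter q χ) where
    open IsDirichletCharacter isχ

    private
      χ-+-multipleℕ : ∀ x n → χ (x + + n * + q) ≡ χ x
      χ-+-multipleℕ x zero    = cong χ (ℤP.+-identityʳ x)
      χ-+-multipleℕ x (suc n) = begin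
        χ (x + (1ℤ + + n) * + q)   ≡⟨ cong χ (shift x (+ n) (+ q)) ⟩
        χ (x + + n * + q + + q)    ≡⟨ periodic (x + + n * + q) ⟩
        χ (x + + n * + q)          ≡⟨ χ-+-multipleℕ x n ⟩
        χ x                        ∎
        where
        open ≡-Reasoning
        shift : ∀ x n q → x + (1ℤ + n) * q ≡ x + n * q + q
        shift = solve-∀

    χ-periodic : ∀ x k → χ (x + k * + q) ≡ χ x
    χ-periodic x (+ n)        = χ-+-multipleℕ x n
    χ-periodic x k@(-[1+ n ]) =
      sym (trans (cong χ (x≡x+kq-kq x k (+ q))) (χ-+-multipleℕ (x + k * + q) (suc n)))
      where
      x≡x+kq-kq : ∀ x k q → x ≡ x + k * q + (- k) * q
      x≡x+kq-kq = solve-∀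

    χ-%ℕ : ∀ x → χ (+ (x %ℕ q)) ≡ χ x
    χ-%ℕ x = sym (trans (cong χ (a≡a%ℕn+[a/ℕn]*n x q)) (χ-periodic (+ (x %ℕ q)) (x /ℕ q)))

    χ-cong : ∀ x y → + q ∣ x - y → χ x ≡ χ y
    χ-cong x y q∣x-y = trans (sym (χ-%ℕ x)) (trans (cong (χ ∘ +_) (%ℕ-cong q x y q∣x-y)) (χ-%ℕ y))

    χ[0]≡0 : 1 ℕ.< q → χ 0ℤ ≡ 0ℤ
    χ[0]≡0 1<q = zero-out 0ℤ λ 0⊥q →
      ℕP.<⇒≢ 1<q (sym (trans (sym (gcd-identityˡ q)) (Coprimality.coprime⇒gcd≡1 0⊥q)))

    χ≢0⇒coprime : ∀ b → χ b ≢ 0ℤ → Coprime ∣ b ∣ q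
    χ≢0⇒coprime b χb≢0 with coprime? ∣ b ∣ q
    ... | yes b⊥q = b⊥q
    ... | no ¬b⊥q = ⊥-elim (χb≢0 (zero-out b ¬b⊥q))

    Σ-dilate : ∀ b F → χ b ≢ 0ℤ → Σ[ s < q ] F ((b * + s) %ℕ q) ≡ Σ< q F
    Σ-dilate b F χb≢0 with inverse-mod b q (χ≢0⇒coprime b χb≢0)
    ... | b⁻¹ , q∣bb⁻¹-1 =
      trans (Σ-cong q (λ s _ → cong (λ x → F (x %ℕ q)) (sym (ℤP.+-identityʳ (b * + s)))))
            (Σ-affine q {b} {b⁻¹} q∣bb⁻¹-1 0ℤ F)

    Σχ≡0 : ∀ b → χ b ≡ -1ℤ → Σ[ n < q ] χ (+ n) ≡ 0ℤ
    Σχ≡0 b χb≡-1 = x≡-x⇒x≡0 (begin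
      Σ[ n < q ] χ (+ n)                   ≡⟨ Σ-dilate b (χ ∘ +_) χb≢0 ⟨
      Σ[ n < q ] χ (+ ((b * + n) %ℕ q))     ≡⟨ Σ-cong q (λ n _ → χ[bn]≡-χ[n] n) ⟩
      Σ[ n < q ] (- χ (+ n))               ≡⟨ Σ-distrib-neg q (χ ∘ +_) ⟩
      - (Σ[ n < q ] χ (+ n))               ∎)
      where
      open ≡-Reasoning
      χb≢0 : χ b ≢ 0ℤ
      χb≢0 χb≡0 with trans (sym χb≡0) χb≡-1
      ... | ()
      χ[bn]≡-χ[n] : ∀ n → χ (+ ((b * + n) %ℕ q)) ≡ - χ (+ n)
      χ[bn]≡-χ[n] n = begin
        χ (+ ((b * + n) %ℕ q))  ≡⟨ χ-%ℕ (b * + n) ⟩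
        χ (b * + n)             ≡⟨ mult b (+ n) ⟩
        χ b * χ (+ n)           ≡⟨ cong (_* χ (+ n)) χb≡-1 ⟩
        -1ℤ * χ (+ n)           ≡⟨ ℤP.-1*i≡-i (χ (+ n)) ⟩
        - χ (+ n)               ∎
      x≡-x⇒x≡0 : ∀ {x} → x ≡ - x → x ≡ 0ℤ
      x≡-x⇒x≡0 {+ zero} _ = refl
      x≡-x⇒x≡0 {+ suc _}  ()
      x≡-x⇒x≡0 { -[1+ _ ]} ()

    χ[kq+u]≡χ[u] : ∀ k u → χ (+ (k ℕ.* q ℕ.+ u)) ≡ χ (+ u)
    χ[kq+u]≡χ[u] k u = trans (cong χ (pos-kq+u k u)) (χ-periodic (+ u) (+ k))
      where
      pos-kq+u : ∀ k u → + (k ℕ.* q ℕ.+ u) ≡ + u + + k * + q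
      pos-kq+u k u = trans (ℤP.pos-+ (k ℕ.* q) u) (trans (cong (_+ + u) (ℤP.pos-* k q)) (ℤP.+-comm (+ k * + q) (+ u)))

    Σχ-multiple≡0 : Σ[ n < q ] χ (+ n) ≡ 0ℤ → ∀ m → Σ[ n < m ℕ.* q ] χ (+ n) ≡ 0ℤ
    Σχ-multiple≡0 Σχ≡0 m = begin
      Σ[ n < m ℕ.* q ] χ (+ n)        ≡⟨ Σ-periodic m q (χ ∘ +_) χ[kq+u]≡χ[u] ⟩
      Σ[ _ < m ] Σ[ n < q ] χ (+ n)   ≡⟨ Σ-cong m (λ _ _ → Σχ≡0) ⟩
      Σ[ _ < m ] 0ℤ                   ≡⟨ Σ-zero m ⟩
      0ℤ                              ∎
      where open ≡-Reasoning

  -- The first moment of a primitive quadratic character of odd conductor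

  odd⇒∣2⇒≡1 : ∀ {d q} → ¬ 2 ℕD.∣ q → d ℕD.∣ 2 → d ℕD.∣ q → d ≡ 1
  odd⇒∣2⇒≡1 {zero} _ 0∣2 _ with ℕD.0∣⇒≡0 0∣2
  ... | ()
  odd⇒∣2⇒≡1 {1}                  _   _   _   = refl
  odd⇒∣2⇒≡1 {2}                  odd _   2∣q = ⊥-elim (odd 2∣q)
  odd⇒∣2⇒≡1 {suc (suc (suc d))} _   d∣2 _   with ℕD.∣⇒≤ d∣2
  ... | s≤s (s≤s ())

  module FirstMoment {q : ℕ} .{{_ : NonZero q}} {χ : ℤ → ℤ} (isχ : IsDirichletCharacter q χ)
    (prim : IsPrimitive q χ) (quad : IsQuadratic χ) (4<q : 4 ℕ.< q) (odd : ¬ 2 ℕD.∣ q) where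
    open IsDirichletCharacter isχ
    open DirichletCharacter isχ

    A : ℤ
    A = Σ[ n < q ] χ (+ n) * + n

    q∣[1-χ[b]b]A : ∀ b → χ b ≢ 0ℤ → + q ∣ (1ℤ - χ b * b) * A
    q∣[1-χ[b]b]A b χb≢0 = subst (+ q ∣_) ΣD≡[1-χ[b]b]A (Σ-∣ q (+ q) D q∣D)
      where
      F : ℕ → ℤ
      F t = χ (+ t) * + t
      r : ℕ → ℕ
      r s = (b * + s) %ℕ q
      D : ℕ → ℤ
      D s = F (r s) - χ b * b * F s
      q∣D : ∀ s → s ℕ.< q → + q ∣ D s
      q∣D s _ = subst (+ q ∣_) (trans (rearrange (χ b) (χ (+ s)) b (+ s) (+ r s))
                                       (cong (λ v → v * + r s - χ b * b * F s) (sym χ[r]≡χ[b]χ[s])))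
        (∣n⇒∣m*n (- (χ b * χ (+ s))) (∣x-x%ℕq q (b * + s)))
        where
        χ[r]≡χ[b]χ[s] : χ (+ r s) ≡ χ b * χ (+ s)
        χ[r]≡χ[b]χ[s] = trans (χ-%ℕ (b * + s)) (mult b (+ s))
        rearrange : ∀ χb χs b s r → - (χb * χs) * (b * s - r) ≡ χb * χs * r - χb * b * (χs * s)
        rearrange = solve-∀
      ΣD≡[1-χ[b]b]A : Σ< q D ≡ (1ℤ - χ b * b) * A
      ΣD≡[1-χ[b]b]A = begin
        Σ< q D
          ≡⟨ Σ-distrib-- q (F ∘ r) (λ s → χ b * b * F s) ⟩
        (Σ[ s < q ] F (r s)) - (Σ[ s < q ] χ b * b * F s)
          ≡⟨ cong₂ _-_ (Σ-dilate b F χb≢0) (Σ-*ˡ q (χ b * b) F) ⟩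
        A - χ b * b * A
          ≡⟨ factor (χ b * b) A ⟩
        (1ℤ - χ b * b) * A
          ∎
        where
        open ≡-Reasoning
        factor : ∀ u a → a - u * a ≡ (1ℤ - u) * a
        factor = solve-∀

    -- e is the denominator of A / q in lowest terms
    private
      g = gcd q ∣ A ∣
      instance
        g≢0 : NonZero g
        g≢0 = ℕ.≢-nonZero (gcd[m,n]≢0 q ∣ A ∣ (inj₁ (ℕ.≢-nonZero⁻¹ q)))

    e : ℕ
    e = q ℕ./ g

    private
      q≡e*g : q ≡ e ℕ.* g
      q≡e*g = sym (m/n*n≡m (gcd[m,n]∣m q ∣ A ∣))
      ∣A∣≡[∣A∣/g]*g : ∣ A ∣ ≡ (∣ A ∣ ℕ./ g) ℕ.* g
      ∣A∣≡[∣A∣/g]*g = sym (m/n*n≡m (gcd[m,n]∣n q ∣ A ∣))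

    e∣1-χ[b]b : ∀ b → χ b ≢ 0ℤ → e ℕD.∣ ∣ 1ℤ - χ b * b ∣
    e∣1-χ[b]b b χb≢0 = Coprimality.coprime-divisor (Coprimality.coprime-/gcd q ∣ A ∣)
      (ℕD.*-cancelʳ-∣ g (subst₂ ℕD._∣_ q≡e*g regroup (∣⇒∣ᵤ (q∣[1-χ[b]b]A b χb≢0))))
      where
      β = ∣ 1ℤ - χ b * b ∣
      regroup : ∣ (1ℤ - χ b * b) * A ∣ ≡ (∣ A ∣ ℕ./ g) ℕ.* β ℕ.* g
      regroup = begin
        ∣ (1ℤ - χ b * b) * A ∣           ≡⟨ ℤP.abs-* (1ℤ - χ b * b) A ⟩
        β ℕ.* ∣ A ∣                      ≡⟨ cong (β ℕ.*_) ∣A∣≡[∣A∣/g]*g ⟩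
        β ℕ.* ((∣ A ∣ ℕ./ g) ℕ.* g)      ≡⟨ ℕP.*-assoc β _ g ⟨
        β ℕ.* (∣ A ∣ ℕ./ g) ℕ.* g        ≡⟨ cong (ℕ._* g) (ℕP.*-comm β _) ⟩
        (∣ A ∣ ℕ./ g) ℕ.* β ℕ.* g        ∎
        where open ≡-Reasoning

    private
      χ≢0⇒±1 : ∀ n → χ n ≢ 0ℤ → χ n ≡ 1ℤ ⊎ χ n ≡ -1ℤ
      χ≢0⇒±1 n χn≢0 with proj₁ quad n
      ... | inj₁ χn≡0 = ⊥-elim (χn≢0 χn≡0)
      ... | inj₂ ±1   = ±1

      2⊥q : Coprime 2 q
      2⊥q (d∣2 , d∣q) = odd⇒∣2⇒≡1 odd d∣2 d∣q

      e∣q : e ℕD.∣ q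
      e∣q = ℕD.divides g (trans q≡e*g (ℕP.*-comm e g))

    -- b = 2 gives e ∣ 1 or e ∣ 3
    e≤3 : e ℕ.≤ 3
    e≤3 = bound (χ≢0⇒±1 (+ 2) χ[2]≢0) (e∣1-χ[b]b (+ 2) χ[2]≢0)
      where
      χ[2]≢0 = nonzero (+ 2) 2⊥q
      bound : ∀ {v} → v ≡ 1ℤ ⊎ v ≡ -1ℤ → e ℕD.∣ ∣ 1ℤ - v * + 2 ∣ → e ℕ.≤ 3
      bound (inj₁ refl) e∣1 = ℕP.≤-trans (ℕD.∣⇒≤ e∣1) (s≤s z≤n)
      bound (inj₂ refl) e∣3 = ℕD.∣⇒≤ e∣3

    e<q : e ℕ.< q
    e<q = ℕP.≤-<-trans e≤3 (ℕP.<-trans (ℕP.n<1+n 3) 4<q)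

    -- primitivity supplies n ≡ 1 (mod e) with χ n = -1, so e ∣ 1 + n and e ∣ n - 1
    e∣2 : e ℕD.∣ 2
    e∣2 = from-witness (prim e e∣q e<q)
      where
      from-witness : (∃ λ n → (+ e ℤD.∣ (n - 1ℤ)) × Coprime ∣ n ∣ q × χ n ≢ 1ℤ) → e ℕD.∣ 2
      from-witness (n , e∣n-1 , n⊥q , χn≢1) =
        ∣⇒∣ᵤ (subst (+ e ∣_) (1+n-[n-1]≡2 n) (∣m∣n⇒∣m-n e∣1+n (∣ᵤ⇒∣ e∣n-1)))
        where
        χn≢0 = nonzero n n⊥q
        χn≡-1 : χ n ≡ -1ℤ
        χn≡-1 with χ≢0⇒±1 n χn≢0
        ... | inj₁ χn≡1  = ⊥-elim (χn≢1 χn≡1)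
        ... | inj₂ χn≡-1 = χn≡-1
        e∣1+n : + e ∣ 1ℤ - -1ℤ * n
        e∣1+n = ∣ᵤ⇒∣ (subst (λ v → e ℕD.∣ ∣ 1ℤ - v * n ∣) χn≡-1 (e∣1-χ[b]b n χn≢0))
        1+n-[n-1]≡2 : ∀ n → 1ℤ - -1ℤ * n - (n - 1ℤ) ≡ + 2
        1+n-[n-1]≡2 = solve-∀

    q∣Σχ[n]n : + q ∣ A
    q∣Σχ[n]n = ∣ᵤ⇒∣ (ℕD.divides (∣ A ∣ ℕ./ g) (trans ∣A∣≡[∣A∣/g]*g (cong ((∣ A ∣ ℕ./ g) ℕ.*_) g≡q)))
      where
      g≡q : g ≡ q
      g≡q = begin
        g           ≡⟨ ℕP.*-identityˡ g ⟨
        1 ℕ.* g     ≡⟨ cong (ℕ._* g) (odd⇒∣2⇒≡1 odd e∣2 e∣q) ⟨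
        e ℕ.* g     ≡⟨ q≡e*g ⟨
        q           ∎
        where open ≡-Reasoning

  -- Rationals with a prescribed denominator

  -- the unnormalised denominator is stored as n - 1, so n should be positive
  infix 4 _≈_÷_
  _≈_÷_ : ℚ → ℤ → ℕ → Set
  p ≈ i ÷ n = toℚᵘ p ℚᵘ.≃ mkℚᵘ i (ℕ.pred n)

  ÷-/ : ∀ i k → i ℚ./ suc k ≈ i ÷ suc k
  ÷-/ i k = ℚP.toℚᵘ-fromℚᵘ (mkℚᵘ i k)

  ÷-0 : ∀ k → 0ℚ ≈ 0ℤ ÷ suc k
  ÷-0 k = *≡* refl

  ÷-+ : ∀ {p p′ i j m n} → p ≈ i ÷ suc m → p′ ≈ j ÷ suc n →
        p ℚ.+ p′ ≈ i * + suc n + j * + suc m ÷ suc m ℕ.* suc n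
  ÷-+ {p} {p′} p≈ p′≈ = ℚᵘP.≃-trans (ℚP.toℚᵘ-homo-+ p p′) (ℚᵘP.+-cong p≈ p′≈)

  ÷-* : ∀ {p p′ i j m n} → p ≈ i ÷ suc m → p′ ≈ j ÷ suc n → p ℚ.* p′ ≈ i * j ÷ suc m ℕ.* suc n
  ÷-* {p} {p′} p≈ p′≈ = ℚᵘP.≃-trans (ℚP.toℚᵘ-homo-* p p′) (ℚᵘP.*-cong p≈ p′≈)

  ÷-neg : ∀ {p i m} → p ≈ i ÷ suc m → ℚ.- p ≈ - i ÷ suc m
  ÷-neg {p} p≈ = ℚᵘP.≃-trans (ℚP.toℚᵘ-homo‿- p) (ℚᵘP.-‿cong p≈)

  ÷-rescale : ∀ {p i j m n} → p ≈ i ÷ suc m → i * + suc n ≡ j * + suc m → p ≈ j ÷ suc n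
  ÷-rescale p≈ eq = ℚᵘP.≃-trans p≈ (*≡* eq)

  ÷-+-common : ∀ {p p′ i j K} → p ≈ i ÷ suc K → p′ ≈ j ÷ suc K → p ℚ.+ p′ ≈ i + j ÷ suc K
  ÷-+-common {i = i} {j} {K} p≈ p′≈ = ÷-rescale (÷-+ p≈ p′≈)
    (trans (factor i j (+ suc K)) (cong ((i + j) *_) (sym (ℤP.pos-* (suc K) (suc K)))))
    where
    factor : ∀ i j k → (i * k + j * k) * k ≡ (i + j) * (k * k)
    factor = solve-∀

  ÷-unique : ∀ {p p′ i j m n} → p ≈ i ÷ suc m → p′ ≈ j ÷ suc n → i * + suc n ≡ j * + suc m → p ≡ p′
  ÷-unique p≈ p′≈ eq = ℚP.toℚᵘ-injective (ℚᵘP.≃-trans (÷-rescale p≈ eq) (ℚᵘP.≃-sym p′≈))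

  Integral : ℚ → Set
  Integral p = ∃ λ z → p ≡ fromℤ z

  Integral-*ˡ : ∀ g {p} → Integral p → Integral (fromℤ g ℚ.* p)
  Integral-*ˡ g (z , p≡z) = g * z , trans (cong (fromℤ g ℚ.*_) p≡z)
    (÷-unique (÷-* (÷-/ g 0) (÷-/ z 0)) (÷-/ (g * z) 0) refl)

  sumℚ-÷ : ∀ n h K (F : ℕ → ℚ) (g : ℕ → ℤ) → (∀ i → i ℕ.< n → F (h i) ≈ g (h i) ÷ suc K) →
           sumℚ (map F (applyUpTo h n)) ≈ Σ[ i < n ] g (h i) ÷ suc K
  sumℚ-÷ zero    h K F g F≈g = ÷-0 K
  sumℚ-÷ (suc n) h K F g F≈g = ÷-+-common (F≈g 0 (s≤s z≤n))
    (sumℚ-÷ n (h ∘ suc) K F g (λ i i<n → F≈g (suc i) (s≤s i<n)))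

  -- The first Bernoulli function at i / c

  floor≡↥/ℕ↧ : ∀ p → floor p ≡ ↥ p /ℕ ↧ₙ p
  floor≡↥/ℕ↧ (mkℚ n d _) = div-pos-is-/ℕ n (suc d)

  floor-/ : ∀ i k → floor (i ℚ./ suc k) ≡ i /ℕ suc k
  floor-/ i k = trans (floor≡↥/ℕ↧ p) (sym (/ℕ-unique (suc k) i (r ℕ.* G) t rG<c i≡rG+tc))
    where
    p = i ℚ./ suc k
    G = gcd ∣ i ∣ (suc k)
    r = ↥ p %ℕ ↧ₙ p
    t = ↥ p /ℕ ↧ₙ p
    ↧G≡c : ↧ₙ p ℕ.* G ≡ suc k
    ↧G≡c = ℤP.+-injective (trans (ℤP.pos-* (↧ₙ p) G) (ℚP.↧-/ i (suc k)))
    instance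
      G≢0 : NonZero G
      G≢0 = ℕP.m*n≢0⇒n≢0 (↧ₙ p) {{subst NonZero (sym ↧G≡c) _}}
    rG<c : r ℕ.* G ℕ.< suc k
    rG<c = subst (r ℕ.* G ℕ.<_) ↧G≡c (ℕP.*-monoˡ-< G (n%ℕd<d (↥ p) (↧ₙ p)))
    i≡rG+tc : i ≡ + (r ℕ.* G) + t * + suc k
    i≡rG+tc = begin
      i                                   ≡⟨ ℚP.↥-/ i (suc k) ⟨
      ↥ p * + G                           ≡⟨ cong (_* + G) (a≡a%ℕn+[a/ℕn]*n (↥ p) (↧ₙ p)) ⟩
      (+ r + t * ↧ p) * + G               ≡⟨ distrib (+ r) t (↧ p) (+ G) ⟩
      + r * + G + t * (↧ p * + G)         ≡⟨ cong (λ v → + r * + G + t * v) (ℚP.↧-/ i (suc k)) ⟩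
      + r * + G + t * + suc k             ≡⟨ cong (_+ t * + suc k) (ℤP.pos-* r G) ⟨
      + (r ℕ.* G) + t * + suc k           ∎
      where
      open ≡-Reasoning
      distrib : ∀ r t d g → (r + t * d) * g ≡ r * g + t * (d * g)
      distrib = solve-∀

  frac-/ : ∀ i k → i ℚ./ suc k ℚ.- fromℤ (floor (i ℚ./ suc k)) ≡ + (i %ℕ suc k) ℚ./ suc k
  frac-/ i k = ÷-unique (÷-+ (÷-/ i k) (÷-neg (÷-/ (floor (i ℚ./ suc k)) 0))) (÷-/ (+ (i %ℕ suc k)) k) (begin
    (i * + 1 + - floor (i ℚ./ suc k) * c) * c
      ≡⟨ cong (λ f → (i * + 1 + - f * c) * c) (floor-/ i k) ⟩
    (i * + 1 + - (i /ℕ suc k) * c) * c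
      ≡⟨ cong (λ x → (x * + 1 + - (i /ℕ suc k) * c) * c) (a≡a%ℕn+[a/ℕn]*n i (suc k)) ⟩
    ((+ r + i /ℕ suc k * c) * + 1 + - (i /ℕ suc k) * c) * c
      ≡⟨ cancel (+ r) (i /ℕ suc k) c ⟩
    + r * (c * + 1)
      ∎)
    where
    open ≡-Reasoning
    c = + suc k
    r = i %ℕ suc k
    cancel : ∀ r t c → ((r + t * c) * + 1 + - t * c) * c ≡ r * (c * + 1)
    cancel = solve-∀

  private
    B₁-frac : ∀ x r → x ℚ.- fromℤ (floor x) ≡ r → r ≢ 0ℚ → B₁ x ≡ r ℚ.- ½
    B₁-frac x r frac≡r r≢0 with x ℚ.- fromℤ (floor x) ℚP.≟ 0ℚ
    ... | yes frac≡0 = ⊥-elim (r≢0 (trans (sym frac≡r) frac≡0))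
    ... | no  _      = cong (ℚ._- ½) frac≡r

    n≢0⇒n/c≢0 : ∀ n k → n ≢ 0 → + n ℚ./ suc k ≢ 0ℚ
    n≢0⇒n/c≢0 n k n≢0 n/c≡0 = n≢0 (ℤP.+-injective (begin
      + n                                   ≡⟨ ℚP.↥-/ (+ n) (suc k) ⟨
      ↥ (+ n ℚ./ suc k) * + gcd n (suc k)  ≡⟨ cong (_* + gcd n (suc k)) (ℚP.p≡0⇒↥p≡0 _ n/c≡0) ⟩
      0ℤ                                    ∎))
      where open ≡-Reasoning

  B₁-numerator : (c : ℕ) .{{_ : NonZero c}} → ℤ → ℤ
  B₁-numerator c x = + 2 * + (x %ℕ c) - + c

  B₁-ratio : ∀ i c .{{_ : NonZero c}} → i %ℕ c ≢ 0 → B₁ (ratio i c) ≈ B₁-numerator c i ÷ 2 ℕ.* c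
  B₁-ratio i c@(suc k) r≢0 = subst (_≈ B₁-numerator c i ÷ 2 ℕ.* c)
    (sym (B₁-frac (i ℚ./ c) _ (frac-/ i k) (n≢0⇒n/c≢0 r k r≢0)))
    (÷-rescale (÷-+ (÷-/ (+ r) k) (÷-neg {p = ½} (÷-/ 1ℤ 1))) (begin
      (+ r * + 2 + - 1ℤ * + c) * + (2 ℕ.* c)   ≡⟨ cong ((+ r * + 2 + - 1ℤ * + c) *_) (ℤP.pos-* 2 c) ⟩
      (+ r * + 2 + - 1ℤ * + c) * (+ 2 * + c)   ≡⟨ regroup (+ r) (+ c) ⟩
      (+ 2 * + r - + c) * (+ c * + 2)          ≡⟨ cong ((+ 2 * + r - + c) *_) (ℤP.pos-* c 2) ⟨
      (+ 2 * + r - + c) * + (c ℕ.* 2)          ∎))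
    where
    open ≡-Reasoning
    r = i %ℕ c
    regroup : ∀ r c → (r * + 2 + - 1ℤ * c) * (+ 2 * c) ≡ (+ 2 * r - c) * (c * + 2)
    regroup = solve-∀

  ratio-+ : ∀ x y q M c .{{_ : NonZero q}} .{{_ : NonZero c}} → c ≡ q ℕ.* M →
            ratio x q ℚ.+ ratio y c ≡ ratio (x * + M + y) c
  ratio-+ x y q@(suc q′) M c@(suc k) c≡qM = ÷-unique (÷-+ (÷-/ x q′) (÷-/ y k)) (÷-/ (x * + M + y) k) (begin
    (x * + c + y * + q) * + c                  ≡⟨ cong (λ z → (x * z + y * + q) * z) +c≡qM ⟩
    (x * (+ q * + M) + y * + q) * (+ q * + M)  ≡⟨ regroup x y (+ q) (+ M) ⟩
    (x * + M + y) * (+ q * (+ q * + M))        ≡⟨ cong (λ z → (x * + M + y) * (+ q * z)) +c≡qM ⟨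
    (x * + M + y) * (+ q * + c)                ≡⟨ cong ((x * + M + y) *_) (ℤP.pos-* q c) ⟨
    (x * + M + y) * + (q ℕ.* c)                ∎)
    where
    open ≡-Reasoning
    +c≡qM : + c ≡ + q * + M
    +c≡qM = trans (cong +_ c≡qM) (ℤP.pos-* q M)
    regroup : ∀ x y q M → (x * (q * M) + y * q) * (q * M) ≡ (x * M + y) * (q * (q * M))
    regroup = solve-∀

  -- Integrality of the newform Dedekind sum

  module ShiftedMoment {q : ℕ} .{{_ : NonZero q}} {χ : ℤ → ℤ}
    (Σχ≡0 : Σ[ n < q ] χ (+ n) ≡ 0ℤ) (q∣Σχ[n]n : + q ∣ Σ[ n < q ] χ (+ n) * + n) where

    Q : ℤ → ℤ
    Q t = Σ[ n < q ] χ (+ n) * + ((+ n + t) %ℕ q)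

    -- Q t ≡ Σ χ(n) (n + t) ≡ Σ χ(n) n (mod q)
    q∣Q : ∀ t → + q ∣ Q t
    q∣Q t = subst (+ q ∣_) ΣD+A≡Q (∣m∣n⇒∣m+n (Σ-∣ q (+ q) D q∣D) q∣Σχ[n]n)
      where
      D : ℕ → ℤ
      D n = χ (+ n) * + ((+ n + t) %ℕ q) - (χ (+ n) * + n + t * χ (+ n))
      q∣D : ∀ n → n ℕ.< q → + q ∣ D n
      q∣D n _ = subst (+ q ∣_) (rearrange (χ (+ n)) (+ n) t (+ ((+ n + t) %ℕ q)))
        (∣n⇒∣m*n (- χ (+ n)) (∣x-x%ℕq q (+ n + t)))
        where
        rearrange : ∀ x n t r → - x * (n + t - r) ≡ x * r - (x * n + t * x)
        rearrange = solve-∀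
      ΣD+A≡Q : Σ< q D + (Σ[ n < q ] χ (+ n) * + n) ≡ Q t
      ΣD+A≡Q = begin
        Σ< q D + A
          ≡⟨ cong (_+ A) (Σ-distrib-- q (λ n → χ (+ n) * + ((+ n + t) %ℕ q)) (λ n → χ (+ n) * + n + t * χ (+ n))) ⟩
        Q t - (Σ[ n < q ] (χ (+ n) * + n + t * χ (+ n))) + A
          ≡⟨ cong (λ z → Q t - z + A) (Σ-distrib-+ q (λ n → χ (+ n) * + n) (λ n → t * χ (+ n))) ⟩
        Q t - (A + (Σ[ n < q ] t * χ (+ n))) + A
          ≡⟨ cong (λ z → Q t - (A + z) + A) (trans (Σ-*ˡ q t (χ ∘ +_)) (trans (cong (t *_) Σχ≡0) (ℤP.*-zeroʳ t))) ⟩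
        Q t - (A + 0ℤ) + A
          ≡⟨ cancel (Q t) A ⟩
        Q t ∎
        where
        open ≡-Reasoning
        A = Σ[ n < q ] χ (+ n) * + n
        cancel : ∀ x a → x - (a + 0ℤ) + a ≡ x
        cancel = solve-∀

    -- opaque, so that conversion checking never unfolds the divisibility proof q∣Q
    opaque
      Q′ : ℤ → ℤ
      Q′ t = _∣_.quotient (q∣Q t)

      Q≡Q′q : ∀ t → Q t ≡ Q′ t * + q
      Q≡Q′q t = _∣_.equality (q∣Q t)

    Q′-%ℕ : ∀ t → Q′ t ≡ Q′ (+ (t %ℕ q))
    Q′-%ℕ t = ℤP.*-cancelʳ-≡ _ _ (+ q) (trans (sym (Q≡Q′q t)) (trans Q-%ℕ (Q≡Q′q (+ (t %ℕ q)))))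
      where
      shift : ∀ n t r → t - r ≡ n + t - (n + r)
      shift = solve-∀
      Q-%ℕ : Q t ≡ Q (+ (t %ℕ q))
      Q-%ℕ = Σ-cong q λ n _ → cong (λ r → χ (+ n) * + r)
        (%ℕ-cong q (+ n + t) (+ n + + (t %ℕ q)) (subst (+ q ∣_) (shift (+ n) t _) (∣x-x%ℕq q t)))

    ΣQ≡0 : Σ[ t < q ] Q (+ t) ≡ 0ℤ
    ΣQ≡0 = begin
      Σ[ t < q ] Q (+ t)
        ≡⟨ Σ-swap q q (λ t n → χ (+ n) * + ((+ n + + t) %ℕ q)) ⟩
      Σ[ n < q ] Σ[ t < q ] χ (+ n) * + ((+ n + + t) %ℕ q)
        ≡⟨ Σ-cong q (λ n _ → trans (Σ-*ˡ q (χ (+ n)) (λ t → + ((+ n + + t) %ℕ q))) (cong (χ (+ n) *_) (Σ-shift n))) ⟩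
      Σ[ n < q ] χ (+ n) * (Σ[ t < q ] + t)
        ≡⟨ Σ-*ʳ q (Σ[ t < q ] + t) (χ ∘ +_) ⟩
      (Σ[ n < q ] χ (+ n)) * (Σ[ t < q ] + t)
        ≡⟨ cong (_* (Σ[ t < q ] + t)) Σχ≡0 ⟩
      0ℤ
        ∎
      where
      open ≡-Reasoning
      Σ-shift : ∀ n → Σ[ t < q ] + ((+ n + + t) %ℕ q) ≡ Σ[ t < q ] + t
      Σ-shift n = trans (Σ-cong q (λ t _ → cong (λ x → + (x %ℕ q)) (n+t≡1*t+n (+ n) (+ t))))
        (Σ-affine q {1ℤ} {1ℤ} (divides 0ℤ refl) (+ n) (λ t → + t))
        where
        n+t≡1*t+n : ∀ n t → n + t ≡ 1ℤ * t + n
        n+t≡1*t+n = solve-∀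

    ΣQ′≡0 : Σ[ t < q ] Q′ (+ t) ≡ 0ℤ
    ΣQ′≡0 = ℤP.*-cancelʳ-≡ _ 0ℤ (+ q) (begin
      (Σ[ t < q ] Q′ (+ t)) * + q    ≡⟨ Σ-*ʳ q (+ q) (Q′ ∘ +_) ⟨
      Σ[ t < q ] Q′ (+ t) * + q      ≡⟨ Σ-cong q (λ t _ → Q≡Q′q (+ t)) ⟨
      Σ[ t < q ] Q (+ t)             ≡⟨ ΣQ≡0 ⟩
      0ℤ                             ∎)
      where open ≡-Reasoning

  module Integrality
    {q₁ q₂ : ℕ} .{{_ : NonZero q₁}} .{{_ : NonZero q₂}} {χ₁ χ₂ : ℤ → ℤ}
    (isχ₂ : IsDirichletCharacter q₂ χ₂) (1<q₂ : 1 ℕ.< q₂)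
    (Σχ₁≡0 : Σ[ n < q₁ ] χ₁ (+ n) ≡ 0ℤ) (q₁∣Σχ₁[n]n : + q₁ ∣ Σ[ n < q₁ ] χ₁ (+ n) * + n)
    (Σχ₂≡0 : Σ[ n < q₂ ] χ₂ (+ n) ≡ 0ℤ)
    (k : ℕ) (q₁q₂∣c : q₁ ℕ.* q₂ ℕD.∣ suc k) {a d : ℤ} (c∣ad-1 : + suc k ∣ a * d - 1ℤ) where

    open ShiftedMoment {χ = χ₁} Σχ₁≡0 q₁∣Σχ₁[n]n
    module χ₂ = DirichletCharacter isχ₂

    c m M : ℕ
    c = suc k
    m = ℕD._∣_.quotient q₁q₂∣c
    M = m ℕ.* q₂

    c≡q₁mq₂ : c ≡ q₁ ℕ.* (m ℕ.* q₂)
    c≡q₁mq₂ = trans (ℕD._∣_.equality q₁q₂∣c) (x∙yz≈y∙xz m q₁ q₂)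

    instance
      M≢0 : NonZero M
      M≢0 = ℕP.m*n≢0⇒n≢0 q₁ {{subst NonZero c≡q₁mq₂ _}}

    +c≡q₁M : + c ≡ + q₁ * + M
    +c≡q₁M = trans (cong +_ c≡q₁mq₂) (ℤP.pos-* q₁ M)

    q₂∣M : + q₂ ∣ + M
    q₂∣M = divides (+ m) (ℤP.pos-* m q₂)

    q₂∣c : + q₂ ∣ + c
    q₂∣c = ∣-trans q₂∣M (divides (+ q₁) +c≡q₁M)

    q₁∣ad-1 : + q₁ ∣ a * d - 1ℤ
    q₁∣ad-1 = ∣-trans (divides (+ M) (trans +c≡q₁M (ℤP.*-comm (+ q₁) (+ M)))) c∣ad-1

    Σχ₁-B₁-numerator : ∀ x → Σ[ n < q₁ ] χ₁ (+ n) * B₁-numerator c (+ n * + M + x) ≡ + 2 * + c * Q′ (x /ℕ M)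
    Σχ₁-B₁-numerator x = begin
      Σ[ n < q₁ ] χ₁ (+ n) * B₁-numerator c (+ n * + M + x)
        ≡⟨ Σ-cong q₁ (λ n _ → split n) ⟩
      Σ[ n < q₁ ] (+ 2 * + M * (χ₁ (+ n) * + ((+ n + t) %ℕ q₁)) + (+ 2 * + v - + c) * χ₁ (+ n))
        ≡⟨ Σ-distrib-+ q₁ (λ n → + 2 * + M * (χ₁ (+ n) * + ((+ n + t) %ℕ q₁))) (λ n → (+ 2 * + v - + c) * χ₁ (+ n)) ⟩
      (Σ[ n < q₁ ] + 2 * + M * (χ₁ (+ n) * + ((+ n + t) %ℕ q₁))) + (Σ[ n < q₁ ] (+ 2 * + v - + c) * χ₁ (+ n))
        ≡⟨ cong₂ _+_ (Σ-*ˡ q₁ (+ 2 * + M) (λ n → χ₁ (+ n) * + ((+ n + t) %ℕ q₁)))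
                     (trans (Σ-*ˡ q₁ (+ 2 * + v - + c) (χ₁ ∘ +_)) (cong ((+ 2 * + v - + c) *_) Σχ₁≡0)) ⟩
      + 2 * + M * Q t + (+ 2 * + v - + c) * 0ℤ
        ≡⟨ cong (λ z → + 2 * + M * z + (+ 2 * + v - + c) * 0ℤ) (Q≡Q′q t) ⟩
      + 2 * + M * (Q′ t * + q₁) + (+ 2 * + v - + c) * 0ℤ
        ≡⟨ regroup (+ M) (Q′ t) (+ q₁) (+ 2 * + v - + c) ⟩
      + 2 * (+ q₁ * + M) * Q′ t
        ≡⟨ cong (λ z → + 2 * z * Q′ t) +c≡q₁M ⟨
      + 2 * + c * Q′ t
        ∎
      where
      open ≡-Reasoning
      t = x /ℕ M
      v = x %ℕ M
      regroup : ∀ M Q q y → + 2 * M * (Q * q) + y * 0ℤ ≡ + 2 * (q * M) * Q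
      regroup = solve-∀
      split : ∀ n → χ₁ (+ n) * B₁-numerator c (+ n * + M + x)
                  ≡ + 2 * + M * (χ₁ (+ n) * + ((+ n + t) %ℕ q₁)) + (+ 2 * + v - + c) * χ₁ (+ n)
      split n = begin
        χ₁ (+ n) * (+ 2 * + ((+ n * + M + x) %ℕ c) - + c)
          ≡⟨ cong (λ z → χ₁ (+ n) * (+ 2 * + z - + c)) (%ℕ-split q₁ M c c≡q₁mq₂ (+ n) x) ⟩
        χ₁ (+ n) * (+ 2 * + (M ℕ.* r ℕ.+ v) - + c)
          ≡⟨ cong (λ z → χ₁ (+ n) * (+ 2 * (z + + v) - + c)) (ℤP.pos-* M r) ⟩
        χ₁ (+ n) * (+ 2 * (+ M * + r + + v) - + c)
          ≡⟨ distrib (χ₁ (+ n)) (+ M) (+ r) (+ v) (+ c) ⟩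
        + 2 * + M * (χ₁ (+ n) * + r) + (+ 2 * + v - + c) * χ₁ (+ n)
          ∎
        where
        r = (+ n + t) %ℕ q₁
        distrib : ∀ χ M r v c → χ * (+ 2 * (M * r + v) - c) ≡ + 2 * M * (χ * r) + (+ 2 * v - c) * χ
        distrib = solve-∀

    σ : ℕ → ℤ
    σ u = (a * + u) /ℕ M

    module Shift (u : ℕ) = AffinePermutation q₁ {a} {d} q₁∣ad-1 (σ u)

    G : ℕ → ℕ → ℤ
    G u s = Q′ (+ Shift.affine u s)

    W : ℕ → ℤ
    W u = Σ[ s < q₁ ] (+ 2 * + (s ℕ.* M ℕ.+ u) - + c) * G u s

    K : ℤ
    K = Σ[ t < q₁ ] + t * Q′ (+ t)

    ΣG≡0 : ∀ u → Σ< q₁ (G u) ≡ 0ℤ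
    ΣG≡0 u = trans (Shift.Σ-affine u (Q′ ∘ +_)) ΣQ′≡0

    -- substituting t = a s + σ u, so that s ≡ d (t - σ u) (mod q₁)
    q₁∣ΣsG-dK : ∀ u → + q₁ ∣ (Σ[ s < q₁ ] + s * G u s) - d * K
    q₁∣ΣsG-dK u = subst (+ q₁ ∣_) ΣF-ΣH≡ΣsG-dK (Σ-∣ q₁ (+ q₁) (λ t → F t - H t) q₁∣F-H)
      where
      open ≡-Reasoning
      F H : ℕ → ℤ
      F t = + Shift.affine⁻¹ u t * Q′ (+ t)
      H t = d * (+ t - σ u) * Q′ (+ t)
      q₁∣F-H : ∀ t → t ℕ.< q₁ → + q₁ ∣ F t - H t
      q₁∣F-H t _ = subst (+ q₁ ∣_) (rearrange (+ Shift.affine⁻¹ u t) (d * (+ t - σ u)) (Q′ (+ t)))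
        (∣n⇒∣m*n (- Q′ (+ t)) (∣x-x%ℕq q₁ (d * (+ t - σ u))))
        where
        rearrange : ∀ r y q → - q * (y - r) ≡ r * q - y * q
        rearrange = solve-∀
      ΣF≡ΣsG : Σ< q₁ F ≡ Σ[ s < q₁ ] + s * G u s
      ΣF≡ΣsG = sym (trans
        (Σ-cong q₁ (λ s s<q₁ → cong (λ z → + z * G u s) (sym (Shift.affine⁻¹-affine u s s<q₁))))
        (Shift.Σ-affine u F))
      ΣH≡dK : Σ< q₁ H ≡ d * K
      ΣH≡dK = begin
        Σ< q₁ H
          ≡⟨ Σ-cong q₁ (λ t _ → distrib (+ t) d (σ u) (Q′ (+ t))) ⟩
        Σ[ t < q₁ ] (d * (+ t * Q′ (+ t)) - d * σ u * Q′ (+ t))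
          ≡⟨ Σ-distrib-- q₁ (λ t → d * (+ t * Q′ (+ t))) (λ t → d * σ u * Q′ (+ t)) ⟩
        (Σ[ t < q₁ ] d * (+ t * Q′ (+ t))) - (Σ[ t < q₁ ] d * σ u * Q′ (+ t))
          ≡⟨ cong₂ _-_ (Σ-*ˡ q₁ d (λ t → + t * Q′ (+ t))) (Σ-*ˡ q₁ (d * σ u) (Q′ ∘ +_)) ⟩
        d * K - d * σ u * (Σ[ t < q₁ ] Q′ (+ t))
          ≡⟨ cong (λ z → d * K - d * σ u * z) ΣQ′≡0 ⟩
        d * K - d * σ u * 0ℤ
          ≡⟨ cancel (d * K) (d * σ u) ⟩
        d * K
          ∎
        where
        distrib : ∀ t d s q → d * (t - s) * q ≡ d * (t * q) - d * s * q
        distrib = solve-∀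
        cancel : ∀ x y → x - y * 0ℤ ≡ x
        cancel = solve-∀
      ΣF-ΣH≡ΣsG-dK : Σ[ t < q₁ ] (F t - H t) ≡ (Σ[ s < q₁ ] + s * G u s) - d * K
      ΣF-ΣH≡ΣsG-dK = trans (Σ-distrib-- q₁ F H) (cong₂ _-_ ΣF≡ΣsG ΣH≡dK)

    W≡2MΣsG : ∀ u → W u ≡ + 2 * + M * (Σ[ s < q₁ ] + s * G u s)
    W≡2MΣsG u = begin
      W u
        ≡⟨ Σ-cong q₁ (λ s _ → trans (cong (λ z → (+ 2 * (z + + u) - + c) * G u s) (ℤP.pos-* s M))
                                    (distrib (+ s) (+ M) (+ u) (+ c) (G u s))) ⟩
      Σ[ s < q₁ ] (+ 2 * + M * (+ s * G u s) + (+ 2 * + u - + c) * G u s)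
        ≡⟨ Σ-distrib-+ q₁ (λ s → + 2 * + M * (+ s * G u s)) (λ s → (+ 2 * + u - + c) * G u s) ⟩
      (Σ[ s < q₁ ] + 2 * + M * (+ s * G u s)) + (Σ[ s < q₁ ] (+ 2 * + u - + c) * G u s)
        ≡⟨ cong₂ _+_ (Σ-*ˡ q₁ (+ 2 * + M) (λ s → + s * G u s))
                     (trans (Σ-*ˡ q₁ (+ 2 * + u - + c) (G u)) (cong ((+ 2 * + u - + c) *_) (ΣG≡0 u))) ⟩
      + 2 * + M * (Σ[ s < q₁ ] + s * G u s) + (+ 2 * + u - + c) * 0ℤ
        ≡⟨ cancel (+ 2 * + M * (Σ[ s < q₁ ] + s * G u s)) (+ 2 * + u - + c) ⟩
      + 2 * + M * (Σ[ s < q₁ ] + s * G u s)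
        ∎
      where
      open ≡-Reasoning
      distrib : ∀ s M u c g → (+ 2 * (s * M + u) - c) * g ≡ + 2 * M * (s * g) + (+ 2 * u - c) * g
      distrib = solve-∀
      cancel : ∀ x y → x + y * 0ℤ ≡ x
      cancel = solve-∀

    2c∣W-2MdK : ∀ u → + 2 * + c ∣ W u - + 2 * + M * (d * K)
    2c∣W-2MdK u = subst₂ _∣_ 2Mq₁≡2c 2M[ΣsG-dK]≡W-2MdK (*-monoʳ-∣ (+ 2 * + M) (q₁∣ΣsG-dK u))
      where
      2Mq₁≡2c : + 2 * + M * + q₁ ≡ + 2 * + c
      2Mq₁≡2c = trans (regroup (+ M) (+ q₁)) (cong (+ 2 *_) (sym +c≡q₁M))
        where
        regroup : ∀ M q → + 2 * M * q ≡ + 2 * (q * M)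
        regroup = solve-∀
      2M[ΣsG-dK]≡W-2MdK : + 2 * + M * ((Σ[ s < q₁ ] + s * G u s) - d * K) ≡ W u - + 2 * + M * (d * K)
      2M[ΣsG-dK]≡W-2MdK = trans (distrib (+ 2 * + M) (Σ[ s < q₁ ] + s * G u s) (d * K))
        (cong (_- + 2 * + M * (d * K)) (sym (W≡2MΣsG u)))
        where
        distrib : ∀ x y z → x * (y - z) ≡ x * y - x * z
        distrib = solve-∀

    p : ℕ → ℤ
    p j = χ₂ (+ j) * (+ 2 * + j - + c) * Q′ ((a * + j) /ℕ M)

    P : ℤ
    P = Σ< c p

    P≡Σχ₂W : P ≡ Σ[ u < M ] χ₂ (+ u) * W u
    P≡Σχ₂W = begin
      P                                          ≡⟨ cong (λ n → Σ< n p) c≡q₁mq₂ ⟩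
      Σ< (q₁ ℕ.* M) p                            ≡⟨ Σ-blocks q₁ M p ⟩
      Σ[ s < q₁ ] Σ[ u < M ] p (s ℕ.* M ℕ.+ u)    ≡⟨ Σ-swap q₁ M (λ s u → p (s ℕ.* M ℕ.+ u)) ⟩
      Σ[ u < M ] Σ[ s < q₁ ] p (s ℕ.* M ℕ.+ u)    ≡⟨ Σ-cong M (λ u _ → trans (Σ-cong q₁ (λ s _ → p[sM+u] s u))
                                                      (Σ-*ˡ q₁ (χ₂ (+ u)) (λ s → (+ 2 * + (s ℕ.* M ℕ.+ u) - + c) * G u s))) ⟩
      Σ[ u < M ] χ₂ (+ u) * W u                  ∎
      where
      open ≡-Reasoning
      χ₂[sM+u]≡χ₂[u] : ∀ s u → χ₂ (+ (s ℕ.* M ℕ.+ u)) ≡ χ₂ (+ u)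
      χ₂[sM+u]≡χ₂[u] s u =
        trans (cong (λ n → χ₂ (+ (n ℕ.+ u))) (sym (ℕP.*-assoc s m q₂))) (χ₂.χ[kq+u]≡χ[u] (s ℕ.* m) u)
      Q′[a[sM+u]/M]≡G : ∀ s u → Q′ ((a * + (s ℕ.* M ℕ.+ u)) /ℕ M) ≡ G u s
      Q′[a[sM+u]/M]≡G s u = begin
        Q′ ((a * + (s ℕ.* M ℕ.+ u)) /ℕ M)       ≡⟨ cong (λ z → Q′ ((a * (z + + u)) /ℕ M)) (ℤP.pos-* s M) ⟩
        Q′ ((a * (+ s * + M + + u)) /ℕ M)       ≡⟨ cong (λ z → Q′ (z /ℕ M)) (distrib a (+ s) (+ M) (+ u)) ⟩
        Q′ ((a * + u + a * + s * + M) /ℕ M)     ≡⟨ cong Q′ ([x+kq]/ℕq≡x/ℕq+k M (a * + u) (a * + s)) ⟩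
        Q′ (σ u + a * + s)                      ≡⟨ Q′-%ℕ (σ u + a * + s) ⟩
        Q′ (+ ((σ u + a * + s) %ℕ q₁))          ≡⟨ cong (λ z → Q′ (+ (z %ℕ q₁))) (ℤP.+-comm (σ u) (a * + s)) ⟩
        G u s                                   ∎
        where
        distrib : ∀ a s M u → a * (s * M + u) ≡ a * u + a * s * M
        distrib = solve-∀
      p[sM+u] : ∀ s u → p (s ℕ.* M ℕ.+ u) ≡ χ₂ (+ u) * ((+ 2 * + (s ℕ.* M ℕ.+ u) - + c) * G u s)
      p[sM+u] s u = trans
        (cong₂ (λ x y → x * (+ 2 * + (s ℕ.* M ℕ.+ u) - + c) * y) (χ₂[sM+u]≡χ₂[u] s u) (Q′[a[sM+u]/M]≡G s u))
        (ℤP.*-assoc (χ₂ (+ u)) (+ 2 * + (s ℕ.* M ℕ.+ u) - + c) (G u s))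

    2c∣P : + 2 * + c ∣ P
    2c∣P = subst (+ 2 * + c ∣_) (sym P≡Σχ₂[W-E])
      (Σ-∣ M (+ 2 * + c) (λ u → χ₂ (+ u) * (W u - E)) (λ u _ → ∣n⇒∣m*n (χ₂ (+ u)) (2c∣W-2MdK u)))
      where
      open ≡-Reasoning
      E : ℤ
      E = + 2 * + M * (d * K)
      R : ℤ
      R = Σ[ u < M ] χ₂ (+ u) * (W u - E)
      P≡Σχ₂[W-E] : P ≡ R
      P≡Σχ₂[W-E] = begin
        P
          ≡⟨ P≡Σχ₂W ⟩
        Σ[ u < M ] χ₂ (+ u) * W u
          ≡⟨ Σ-cong M (λ u _ → split (χ₂ (+ u)) (W u) E) ⟩
        Σ[ u < M ] (χ₂ (+ u) * (W u - E) + E * χ₂ (+ u))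
          ≡⟨ Σ-distrib-+ M (λ u → χ₂ (+ u) * (W u - E)) (λ u → E * χ₂ (+ u)) ⟩
        R + (Σ[ u < M ] E * χ₂ (+ u))
          ≡⟨ cong (_+_ R) (Σ-*ˡ M E (χ₂ ∘ +_)) ⟩
        R + E * (Σ[ u < M ] χ₂ (+ u))
          ≡⟨ cong (λ z → R + E * z) (χ₂.Σχ-multiple≡0 Σχ₂≡0 m) ⟩
        R + E * 0ℤ
          ≡⟨ cancel R E ⟩
        R
          ∎
        where
        split : ∀ x w e → x * w ≡ x * (w - e) + e * x
        split = solve-∀
        cancel : ∀ x e → x + e * 0ℤ ≡ x
        cancel = solve-∀

    T : ℕ → ℕ → ℤ
    T j n = χ₂ (+ j) * χ₁ (+ n) * B₁-numerator c (+ j) * B₁-numerator c (+ n * + M + a * + j)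

    ΣT≡2cP : Σ[ j < c ] Σ[ n < q₁ ] T j n ≡ + 2 * + c * P
    ΣT≡2cP = trans (Σ-cong c ΣₙT≡2cp) (Σ-*ˡ c (+ 2 * + c) p)
      where
      ΣₙT≡2cp : ∀ j → j ℕ.< c → Σ[ n < q₁ ] T j n ≡ + 2 * + c * p j
      ΣₙT≡2cp j j<c = begin
        Σ[ n < q₁ ] T j n
          ≡⟨ Σ-cong q₁ (λ n _ → regroup₁ (χ₂ (+ j)) (χ₁ (+ n)) (B₁-numerator c (+ j)) (B₁-numerator c (+ n * + M + a * + j))) ⟩
        Σ[ n < q₁ ] χ₂ (+ j) * B₁-numerator c (+ j) * (χ₁ (+ n) * B₁-numerator c (+ n * + M + a * + j))
          ≡⟨ Σ-*ˡ q₁ (χ₂ (+ j) * B₁-numerator c (+ j)) (λ n → χ₁ (+ n) * B₁-numerator c (+ n * + M + a * + j)) ⟩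
        χ₂ (+ j) * B₁-numerator c (+ j) * (Σ[ n < q₁ ] χ₁ (+ n) * B₁-numerator c (+ n * + M + a * + j))
          ≡⟨ cong₂ (λ r z → χ₂ (+ j) * (+ 2 * + r - + c) * z) (n<q⇒n%ℕq≡n c j j<c) (Σχ₁-B₁-numerator (a * + j)) ⟩
        χ₂ (+ j) * (+ 2 * + j - + c) * (+ 2 * + c * Q′ ((a * + j) /ℕ M))
          ≡⟨ regroup₂ (χ₂ (+ j)) (+ 2 * + j - + c) (+ 2 * + c) (Q′ ((a * + j) /ℕ M)) ⟩
        + 2 * + c * p j
          ∎
        where
        open ≡-Reasoning
        regroup₁ : ∀ x y u w → x * y * u * w ≡ x * u * (y * w)
        regroup₁ = solve-∀
        regroup₂ : ∀ x y z w → x * y * (z * w) ≡ z * (x * y * w)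
        regroup₂ = solve-∀

    private
      χ₂-vanishes-on-q₂ℤ : ∀ x → + q₂ ∣ x → χ₂ x ≡ 0ℤ
      χ₂-vanishes-on-q₂ℤ x q₂∣x =
        trans (χ₂.χ-cong x 0ℤ (subst (+ q₂ ∣_) (sym (ℤP.+-identityʳ x)) q₂∣x)) (χ₂.χ[0]≡0 1<q₂)

      χ₂[j]≢0⇒c∤j : ∀ j → χ₂ (+ j) ≢ 0ℤ → + j %ℕ c ≢ 0
      χ₂[j]≢0⇒c∤j j χ₂[j]≢0 c∣j = χ₂[j]≢0 (χ₂-vanishes-on-q₂ℤ (+ j) (∣-trans q₂∣c (%ℕ≡0⇒∣ c (+ j) c∣j)))

      χ₂[j]≢0⇒c∤nM+aj : ∀ j n → χ₂ (+ j) ≢ 0ℤ → (+ n * + M + a * + j) %ℕ c ≢ 0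
      χ₂[j]≢0⇒c∤nM+aj j n χ₂[j]≢0 c∣nM+aj = χ₂[j]≢0 (χ₂-vanishes-on-q₂ℤ (+ j) q₂∣j)
        where
        q₂∣aj : + q₂ ∣ a * + j
        q₂∣aj = ∣m+n∣m⇒∣n (∣-trans q₂∣c (%ℕ≡0⇒∣ c _ c∣nM+aj)) (∣n⇒∣m*n (+ n) q₂∣M)
        rearrange : ∀ a d j → d * (a * j) - (a * d - 1ℤ) * j ≡ j
        rearrange = solve-∀
        q₂∣j : + q₂ ∣ + j
        q₂∣j = subst (+ q₂ ∣_) (rearrange a d (+ j))
          (∣m∣n⇒∣m-n (∣n⇒∣m*n d q₂∣aj) (∣m⇒∣m*n (+ j) (∣-trans q₂∣c c∣ad-1)))

    term : ℕ → ℕ → ℚ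
    term j n = fromℤ (χ₂ (+ j) * χ₁ (+ n)) ℚ.* B₁ (ratio (+ j) c) ℚ.* B₁ (ratio (+ n) q₁ ℚ.+ ratio (a * + j) c)

    D : ℕ
    D = 2 ℕ.* c ℕ.* (2 ℕ.* c)

    term-÷ : ∀ j n → term j n ≈ T j n ÷ D
    term-÷ j n with χ₂ (+ j) ℤP.≟ 0ℤ
    ... | yes χ₂[j]≡0 = subst₂ (_≈_÷ D) (sym term≡0) (sym T≡0) (÷-0 _)
      where
      B B′ : ℚ
      B  = B₁ (ratio (+ j) c)
      B′ = B₁ (ratio (+ n) q₁ ℚ.+ ratio (a * + j) c)
      term≡0 : term j n ≡ 0ℚ
      term≡0 = trans (cong (λ v → fromℤ (v * χ₁ (+ n)) ℚ.* B ℚ.* B′) χ₂[j]≡0)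
                     (trans (cong (ℚ._* B′) (ℚP.*-zeroˡ B)) (ℚP.*-zeroˡ B′))
      T≡0 : T j n ≡ 0ℤ
      T≡0 = cong (λ v → v * χ₁ (+ n) * B₁-numerator c (+ j) * B₁-numerator c (+ n * + M + a * + j)) χ₂[j]≡0
    ... | no χ₂[j]≢0 = ÷-rescale (÷-* (÷-* (÷-/ (χ₂ (+ j) * χ₁ (+ n)) 0) B₁[j/c]) B₁[n/q₁+aj/c])
      (cong (λ z → T j n * + (z ℕ.* (2 ℕ.* c))) (sym (ℕP.*-identityˡ (2 ℕ.* c))))
      where
      B₁[j/c] : B₁ (ratio (+ j) c) ≈ B₁-numerator c (+ j) ÷ 2 ℕ.* c
      B₁[j/c] = B₁-ratio (+ j) c (χ₂[j]≢0⇒c∤j j χ₂[j]≢0)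
      B₁[n/q₁+aj/c] : B₁ (ratio (+ n) q₁ ℚ.+ ratio (a * + j) c) ≈ B₁-numerator c (+ n * + M + a * + j) ÷ 2 ℕ.* c
      B₁[n/q₁+aj/c] = subst (λ p → B₁ p ≈ B₁-numerator c (+ n * + M + a * + j) ÷ 2 ℕ.* c)
        (sym (ratio-+ (+ n) (a * + j) q₁ M c c≡q₁mq₂))
        (B₁-ratio (+ n * + M + a * + j) c (χ₂[j]≢0⇒c∤nM+aj j n χ₂[j]≢0))

    S-÷ : S-ac χ₁ χ₂ q₁ a c ≈ Σ[ j < c ] Σ[ n < q₁ ] T j n ÷ D
    S-÷ = sumℚ-÷ c id (ℕ.pred D) (λ j → sumℚ (map (term j) (upTo q₁))) (λ j → Σ[ n < q₁ ] T j n)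
      (λ j _ → sumℚ-÷ q₁ id (ℕ.pred D) (term j) (T j) (λ n _ → term-÷ j n))

    S-integral : Integral (S-ac χ₁ χ₂ q₁ a c)
    S-integral = from-quotient 2c∣P
      where
      from-quotient : + 2 * + c ∣ P → Integral (S-ac χ₁ χ₂ q₁ a c)
      from-quotient (divides w P≡w[2c]) = w , ÷-unique S-÷ (÷-/ w 0) (begin
        (Σ[ j < c ] Σ[ n < q₁ ] T j n) * + 1    ≡⟨ ℤP.*-identityʳ _ ⟩
        Σ[ j < c ] Σ[ n < q₁ ] T j n            ≡⟨ ΣT≡2cP ⟩
        + 2 * + c * P                           ≡⟨ cong (+ 2 * + c *_) P≡w[2c] ⟩
        + 2 * + c * (w * (+ 2 * + c))           ≡⟨ regroup w (+ 2 * + c) ⟩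
        w * (+ 2 * + c * (+ 2 * + c))           ≡⟨ cong (w *_) (ℤP.pos-* (2 ℕ.* c) (2 ℕ.* c)) ⟨
        w * + D                                 ∎)
        where
        open ≡-Reasoning
        regroup : ∀ w x → x * (w * x) ≡ w * (x * x)
        regroup = solve-∀

  det⇒ad-1≡bc : ∀ a b c d → a * d - b * c ≡ 1ℤ → a * d - 1ℤ ≡ b * c
  det⇒ad-1≡bc a b c d det = trans (cong (_-_ (a * d)) (sym det)) (cancel (a * d) (b * c))
    where
    cancel : ∀ x y → x - (x - y) ≡ y
    cancel = solve-∀

  S-γ-integral : ∀ {q₁ q₂} .{{_ : NonZero q₁}} .{{_ : NonZero q₂}} {χ₁ χ₂ : ℤ → ℤ} →
    IsDirichletCharacter q₂ χ₂ → 1 ℕ.< q₂ →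
    Σ[ n < q₁ ] χ₁ (+ n) ≡ 0ℤ → + q₁ ∣ (Σ[ n < q₁ ] χ₁ (+ n) * + n) → Σ[ n < q₂ ] χ₂ (+ n) ≡ 0ℤ →
    ∀ a b c d → InΓ₀ (q₁ ℕ.* q₂) a b c d → Integral (S-γ χ₁ χ₂ q₁ a b c d)
  S-γ-integral _ _ _ _ _ _ _ (+ zero) _ _ = 0ℤ , refl
  S-γ-integral {q₁} {χ₁ = χ₁} isχ₂ 1<q₂ Σχ₁≡0 q₁∣A Σχ₂≡0 a b (+ suc k) d (det , q₁q₂∣c) =
    Integrality.S-integral {q₁} {χ₁ = χ₁} isχ₂ 1<q₂ Σχ₁≡0 q₁∣A Σχ₂≡0 k q₁q₂∣c {a} {d}
      (divides b (det⇒ad-1≡bc a b (+ suc k) d det))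
  S-γ-integral {q₁} {χ₁ = χ₁} isχ₂ 1<q₂ Σχ₁≡0 q₁∣A Σχ₂≡0 a b -[1+ k ] d (det , q₁q₂∣c) =
    Integrality.S-integral {q₁} {χ₁ = χ₁} isχ₂ 1<q₂ Σχ₁≡0 q₁∣A Σχ₂≡0 k q₁q₂∣c { - a} { - d}
      (divides (- b) (trans ([-a][-d]-1≡ad-1 a d) (trans (det⇒ad-1≡bc a b -[1+ k ] d det) (b[-c]≡[-b]c b (+ suc k)))))
    where
    [-a][-d]-1≡ad-1 : ∀ a d → - a * - d - 1ℤ ≡ a * d - 1ℤ
    [-a][-d]-1≡ad-1 = solve-∀
    b[-c]≡[-b]c : ∀ b c → b * - c ≡ - b * c
    b[-c]≡[-b]c = solve-∀

  S-γ-integral-quadratic : ∀ {q₁ q₂ χ₁ χ₂} →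
    IsPrimitiveQuadraticChar q₁ χ₁ → IsDirichletCharacter q₂ χ₂ → IsQuadratic χ₂ →
    4 ℕ.< q₁ → 1 ℕ.< q₂ → ¬ 2 ℕD.∣ q₁ →
    ∀ a b c d → InΓ₀ (q₁ ℕ.* q₂) a b c d → Integral (S-γ χ₁ χ₂ q₁ a b c d)
  S-γ-integral-quadratic {q₁} {q₂} {χ₁} (isχ₁ , prim₁ , quad₁) isχ₂ (_ , b₂ , χ₂[b₂]≡-1) 4<q₁ 1<q₂ odd₁ =
    S-γ-integral {χ₁ = χ₁} isχ₂ 1<q₂ (DirichletCharacter.Σχ≡0 isχ₁ b₁ χ₁[b₁]≡-1)
      (FirstMoment.q∣Σχ[n]n isχ₁ prim₁ quad₁ 4<q₁ odd₁) (DirichletCharacter.Σχ≡0 isχ₂ b₂ χ₂[b₂]≡-1)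
    where
    b₁ = proj₁ (proj₂ quad₁)
    χ₁[b₁]≡-1 = proj₂ (proj₂ quad₁)
    instance
      q₁≢0 : NonZero q₁
      q₁≢0 = ℕ.>-nonZero (ℕP.<-trans (s≤s z≤n) 4<q₁)
      q₂≢0 : NonZero q₂
      q₂≢0 = ℕ.>-nonZero (ℕP.<-trans (s≤s z≤n) 1<q₂)

open import Data.Nat as ℕ using (ℕ; _<_; _*_)
open import Data.Nat.Divisibility using (_∣_)
open import Data.Nat.GCD using (gcd)
open import Data.Integer as ℤ using (ℤ; +_; -1ℤ; 1ℤ)
open import Data.Rational as ℚ using (ℚ)
open import Data.Product using (∃)
open import Relation.Nullary using (¬_)
open import Relation.Binary.PropositionalEquality using (_≡_)
open import Data.Nat using (z≤n; s≤s)
open import Data.Nat.Properties using (<-trans)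
open import Data.Product using (_,_)

theorem1p7 : (q₁ q₂ : ℕ) (χ₁ χ₂ : ℤ → ℤ)
  → IsPrimitiveQuadraticChar q₁ χ₁
  → IsPrimitiveQuadraticChar q₂ χ₂
  → χ₁ -1ℤ ℤ.* χ₂ -1ℤ ≡ 1ℤ
  → 4 < q₁ → 4 < q₂
  → ¬ (2 ∣ q₁) → ¬ (2 ∣ q₂)
  → (a b c d : ℤ) → InΓ₀ (q₁ * q₂) a b c d
  → ∃ λ (z : ℤ) → fromℤ (+ gcd q₁ q₂) ℚ.* S-γ χ₁ χ₂ q₁ a b c d ≡ fromℤ z
theorem1p7 q₁ q₂ χ₁ χ₂ χ₁-prim (isχ₂ , _ , quad₂) _ 4<q₁ 4<q₂ odd₁ _ a b c d γ∈Γ₀ =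
  Integral-*ˡ (+ gcd q₁ q₂) (S-γ-integral-quadratic χ₁-prim isχ₂ quad₂ 4<q₁ 1<q₂ odd₁ a b c d γ∈Γ₀)
  where
  1<q₂ : 1 < q₂
  1<q₂ = <-trans (s≤s (s≤s z≤n)) 4<q₂
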